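{- Let $\mathcal{C}$ be a restriction category and $T$ a symmetric monoidal monad on $\mathcal{C}$. Then $T$ is mass preserving if and only if the Kleisli category $\mathcal{C}_T$ is a mass category.
   Context: Composition is diagrammatic ($f;g$ means first $f$, then $g$); the right unitor is $\rho_X:X\to X\otimes I$. A gs-monoidal category is a symmetric monoidal category with, for each object $X$, a discharger $!_X:X\to I$ and duplicator $\nabla_X:X\to X\otimes X$, compatible with the monoidal structure, with $\nabla_X$ coassociative, cocommutative, and $(X,\nabla_X,!_X)$ a comonoid. A restriction category is a gs-monoidal category in which every arrow $f:X\to Y$ satisfies $f;\nabla_Y=\nabla_X;(f\otimes f)$. A symmetric monoidal monad $(T,\eta,\mu)$ is a monad whose functor is lax symmetric monoidal with structure $c_{X,Y}:TX\otimes TY\to T(X\otimes Y)$ and $\eta_I:I\to TI$, such that $\eta,\mu$ are monoidal natural transformations. The Kleisli category $\mathcal{C}_T$ has arrows $X\to Y$ the arrows $X\to TY$, composition $f;^\sharp g=f;T(g);\mu$, tensor $f\otimes^\sharp g=(f\otimes g);c$, structural arrows $\nabla_X;\eta_{X\otimes X}$ and $!_X;\eta_I$. For $f:X\to Y$ in a gs-monoidal category, $\mathrm{mass}(f):=f;!_Y$ and $\mathrm{dom}(f):=\nabla_X;(\mathrm{id}_X\otimes(f;!_Y));\rho^{ -1}_X$; a mass category is one with $\mathrm{dom}(f);\mathrm{mass}(f)=\mathrm{mass}(f)$ for all $f$. $T$ is mass preserving if for all $X$: $\nabla_{TX};c_{X,X};T(!_X\otimes !_X)=T(!_X);T(\rho_I)$.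 -}

module Defs where

open import Level using (Level; _⊔_) renaming (suc to lsuc)
open import Relation.Binary.Structures using (IsEquivalence)

-- Composition is diagrammatic:  f ⨾ g  means first f, then g.

record GSCat (o ℓ e : Level) : Set (lsuc (o ⊔ ℓ ⊔ e)) where
  infixr 9 _⨾_
  infixr 10 _⊗₀_ _⊗₁_
  infix 4 _≈_
  field
    Obj : Set o
    Hom : Obj → Obj → Set ℓ
    _≈_ : ∀ {X Y} → Hom X Y → Hom X Y → Set e
    ≈-equiv : ∀ {X Y} → IsEquivalence (_≈_ {X} {Y})
    id : ∀ {X} → Hom X X
    _⨾_ : ∀ {X Y Z} → Hom X Y → Hom Y Z → Hom X Z
    ⨾-resp : ∀ {X Y Z} {f f' : Hom X Y} {g g' : Hom Y Z} →
             f ≈ f' → g ≈ g' → f ⨾ g ≈ f' ⨾ g'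
    idˡ : ∀ {X Y} (f : Hom X Y) → id ⨾ f ≈ f
    idʳ : ∀ {X Y} (f : Hom X Y) → f ⨾ id ≈ f
    assoc : ∀ {W X Y Z} (f : Hom W X) (g : Hom X Y) (h : Hom Y Z) →
            (f ⨾ g) ⨾ h ≈ f ⨾ (g ⨾ h)

    I : Obj
    _⊗₀_ : Obj → Obj → Obj
    _⊗₁_ : ∀ {X Y X' Y'} → Hom X Y → Hom X' Y' → Hom (X ⊗₀ X') (Y ⊗₀ Y')
    ⊗-resp : ∀ {X Y X' Y'} {f g : Hom X Y} {f' g' : Hom X' Y'} →
             f ≈ g → f' ≈ g' → f ⊗₁ f' ≈ g ⊗₁ g'
    ⊗-id : ∀ {X Y} → id {X} ⊗₁ id {Y} ≈ id
    ⊗-⨾ : ∀ {X Y Z X' Y' Z'} (f : Hom X Y) (g : Hom Y Z) (f' : Hom X' Y') (g' : Hom Y' Z') →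
          (f ⨾ g) ⊗₁ (f' ⨾ g') ≈ (f ⊗₁ f') ⨾ (g ⊗₁ g')

    α : ∀ {X Y Z} → Hom ((X ⊗₀ Y) ⊗₀ Z) (X ⊗₀ (Y ⊗₀ Z))
    α⁻¹ : ∀ {X Y Z} → Hom (X ⊗₀ (Y ⊗₀ Z)) ((X ⊗₀ Y) ⊗₀ Z)
    α-iso₁ : ∀ {X Y Z} → α {X} {Y} {Z} ⨾ α⁻¹ ≈ id
    α-iso₂ : ∀ {X Y Z} → α⁻¹ {X} {Y} {Z} ⨾ α ≈ id
    α-nat : ∀ {X Y Z X' Y' Z'} (f : Hom X X') (g : Hom Y Y') (h : Hom Z Z') →
            ((f ⊗₁ g) ⊗₁ h) ⨾ α ≈ α ⨾ (f ⊗₁ (g ⊗₁ h))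

    lam : ∀ {X} → Hom X (I ⊗₀ X)
    lam⁻¹ : ∀ {X} → Hom (I ⊗₀ X) X
    lam-iso₁ : ∀ {X} → lam {X} ⨾ lam⁻¹ ≈ id
    lam-iso₂ : ∀ {X} → lam⁻¹ {X} ⨾ lam ≈ id
    lam-nat : ∀ {X Y} (f : Hom X Y) → f ⨾ lam ≈ lam ⨾ (id ⊗₁ f)

    ρ : ∀ {X} → Hom X (X ⊗₀ I)
    ρ⁻¹ : ∀ {X} → Hom (X ⊗₀ I) X
    ρ-iso₁ : ∀ {X} → ρ {X} ⨾ ρ⁻¹ ≈ id
    ρ-iso₂ : ∀ {X} → ρ⁻¹ {X} ⨾ ρ ≈ id
    ρ-nat : ∀ {X Y} (f : Hom X Y) → f ⨾ ρ ≈ ρ ⨾ (f ⊗₁ id)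

    σ : ∀ {X Y} → Hom (X ⊗₀ Y) (Y ⊗₀ X)
    σ-nat : ∀ {X Y X' Y'} (f : Hom X X') (g : Hom Y Y') →
            (f ⊗₁ g) ⨾ σ ≈ σ ⨾ (g ⊗₁ f)
    σ-invol : ∀ {X Y} → σ {X} {Y} ⨾ σ ≈ id

    pentagon : ∀ {W X Y Z} →
      (α {W} {X} {Y} ⊗₁ id {Z}) ⨾ α ⨾ (id ⊗₁ α) ≈ α ⨾ α
    triangle : ∀ {X Y} → α {X} {I} {Y} ⨾ (id ⊗₁ lam⁻¹) ≈ ρ⁻¹ ⊗₁ id
    hexagon : ∀ {X Y Z} →
      α {X} {Y} {Z} ⨾ σ ⨾ α ≈ (σ ⊗₁ id) ⨾ α ⨾ (id ⊗₁ σ)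

    ! : ∀ {X} → Hom X I
    ∇ : ∀ {X} → Hom X (X ⊗₀ X)
    !-I : ! {I} ≈ id
    !-⊗ : ∀ {X Y} → ! {X ⊗₀ Y} ≈ (! ⊗₁ !) ⨾ lam⁻¹
    ∇-I : ∇ {I} ≈ ρ
    ∇-⊗ : ∀ {X Y} → ∇ {X ⊗₀ Y} ≈
      (∇ ⊗₁ ∇) ⨾ α ⨾ (id ⊗₁ (α⁻¹ ⨾ (σ ⊗₁ id) ⨾ α)) ⨾ α⁻¹
    ∇-coassoc : ∀ {X} → ∇ {X} ⨾ (id ⊗₁ ∇) ≈ ∇ ⨾ (∇ ⊗₁ id) ⨾ α
    ∇-cocomm : ∀ {X} → ∇ {X} ⨾ σ ≈ ∇
    ∇-counitʳ : ∀ {X} → ∇ {X} ⨾ (id ⊗₁ !) ≈ ρ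
    ∇-counitˡ : ∀ {X} → ∇ {X} ⨾ (! ⊗₁ id) ≈ lam

-- Restriction categories (in the sense of the paper):
-- gs-monoidal categories in which every arrow commutes with duplication.

record RestrictionCat (o ℓ e : Level) : Set (lsuc (o ⊔ ℓ ⊔ e)) where
  field
    gs : GSCat o ℓ e
  open GSCat gs public
  field
    copyable : ∀ {X Y} (f : Hom X Y) → f ⨾ ∇ ≈ ∇ ⨾ (f ⊗₁ f)

record SymMonoidalMonad {o ℓ e : Level} (C : GSCat o ℓ e) : Set (o ⊔ ℓ ⊔ e) where
  open GSCat C
  field
    T₀ : Obj → Obj
    T₁ : ∀ {X Y} → Hom X Y → Hom (T₀ X) (T₀ Y)
    T-resp : ∀ {X Y} {f g : Hom X Y} → f ≈ g → T₁ f ≈ T₁ g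
    T-id : ∀ {X} → T₁ (id {X}) ≈ id
    T-⨾ : ∀ {X Y Z} (f : Hom X Y) (g : Hom Y Z) → T₁ (f ⨾ g) ≈ T₁ f ⨾ T₁ g
    η : ∀ {X} → Hom X (T₀ X)
    μ : ∀ {X} → Hom (T₀ (T₀ X)) (T₀ X)
    η-nat : ∀ {X Y} (f : Hom X Y) → f ⨾ η ≈ η ⨾ T₁ f
    μ-nat : ∀ {X Y} (f : Hom X Y) → T₁ (T₁ f) ⨾ μ ≈ μ ⨾ T₁ f
    μ-unitˡ : ∀ {X} → η {T₀ X} ⨾ μ ≈ id
    μ-unitʳ : ∀ {X} → T₁ (η {X}) ⨾ μ ≈ id
    μ-assoc : ∀ {X} → T₁ (μ {X}) ⨾ μ ≈ μ ⨾ μ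
    c : ∀ {X Y} → Hom (T₀ X ⊗₀ T₀ Y) (T₀ (X ⊗₀ Y))
    c-nat : ∀ {X Y X' Y'} (f : Hom X X') (g : Hom Y Y') →
            (T₁ f ⊗₁ T₁ g) ⨾ c ≈ c ⨾ T₁ (f ⊗₁ g)
    c-assoc : ∀ {X Y Z} →
      (c {X} {Y} ⊗₁ id {T₀ Z}) ⨾ c ⨾ T₁ α ≈ α ⨾ (id ⊗₁ c) ⨾ c
    c-unitˡ : ∀ {X} → (η {I} ⊗₁ id {T₀ X}) ⨾ c ⨾ T₁ lam⁻¹ ≈ lam⁻¹
    c-unitʳ : ∀ {X} → (id {T₀ X} ⊗₁ η {I}) ⨾ c ⨾ T₁ ρ⁻¹ ≈ ρ⁻¹
    c-sym : ∀ {X Y} → σ ⨾ c {Y} {X} ≈ c ⨾ T₁ σ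
    η-monoidal : ∀ {X Y} → (η {X} ⊗₁ η {Y}) ⨾ c ≈ η
    μ-monoidal : ∀ {X Y} → (μ {X} ⊗₁ μ {Y}) ⨾ c ≈ c ⨾ T₁ c ⨾ μ
    μ-monoidal-unit : η {I} ⨾ T₁ (η {I}) ⨾ μ ≈ η {I}

record GSData (o ℓ e : Level) : Set (lsuc (o ⊔ ℓ ⊔ e)) where
  infixr 9 _⨾_
  infixr 10 _⊗₀_ _⊗₁_
  infix 4 _≈_
  field
    Obj : Set o
    Hom : Obj → Obj → Set ℓ
    _≈_ : ∀ {X Y} → Hom X Y → Hom X Y → Set e
    id : ∀ {X} → Hom X X
    _⨾_ : ∀ {X Y Z} → Hom X Y → Hom Y Z → Hom X Z
    I : Obj
    _⊗₀_ : Obj → Obj → Obj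
    _⊗₁_ : ∀ {X Y X' Y'} → Hom X Y → Hom X' Y' → Hom (X ⊗₀ X') (Y ⊗₀ Y')
    ρ⁻¹ : ∀ {X} → Hom (X ⊗₀ I) X
    ! : ∀ {X} → Hom X I
    ∇ : ∀ {X} → Hom X (X ⊗₀ X)

  mass : ∀ {X Y} → Hom X Y → Hom X I
  mass {X} {Y} f = f ⨾ ! {Y}

  dom : ∀ {X Y} → Hom X Y → Hom X X
  dom {X} {Y} f = ∇ {X} ⨾ (id {X} ⊗₁ (f ⨾ ! {Y})) ⨾ ρ⁻¹ {X}

IsMassCategory : ∀ {o ℓ e} → GSData o ℓ e → Set (o ⊔ ℓ ⊔ e)
IsMassCategory D = ∀ {X Y} (f : Hom X Y) → dom f ⨾ mass f ≈ mass f
  where open GSData D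

Kleisli : ∀ {o ℓ e} (C : GSCat o ℓ e) → SymMonoidalMonad C → GSData o ℓ e
Kleisli C M = record
  { Obj = Obj
  ; Hom = λ X Y → Hom X (T₀ Y)
  ; _≈_ = _≈_
  ; id = η
  ; _⨾_ = λ f g → f ⨾ T₁ g ⨾ μ
  ; I = I
  ; _⊗₀_ = _⊗₀_
  ; _⊗₁_ = λ f g → (f ⊗₁ g) ⨾ c
  ; ρ⁻¹ = ρ⁻¹ ⨾ η
  ; ! = ! ⨾ η
  ; ∇ = ∇ ⨾ η
  }
  where
  open GSCat C
  open SymMonoidalMonad M

IsMassPreserving : ∀ {o ℓ e} (C : GSCat o ℓ e) → SymMonoidalMonad C → Set (o ⊔ e)
IsMassPreserving C M = ∀ (X : Obj) →
  ∇ {T₀ X} ⨾ c {X} {X} ⨾ T₁ (! {X} ⊗₁ ! {X}) ≈ T₁ (! {X}) ⨾ T₁ (ρ {I})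
  where
  open GSCat C
  open SymMonoidalMonad M

{-# OPTIONS --safe #-}
-- Let sq = ∇ ⨾ c ⨾ T ρ⁻¹ : TI → TI; for subprobability distributions TI ≅ [0,1] and sq p = p².
-- In C_T, copyability of m = mass f and the monad laws turn dom f ⨾♯ mass f into m ⨾ sq, while
-- mass f = f ⨾ T !; so C_T is a mass category iff f ⨾ T ! ⨾ sq = f ⨾ T ! for all f.
-- Copying T !_X through ∇ and cancelling the isomorphism T ρ, mass preservation at X says
-- T !_X ⨾ sq = T !_X. The former condition is the latter precomposed with f, and f = id gives it back.
module Submission where

open import Defs
open import Function.Bundles using (_⇔_; mk⇔; Equivalence)
open import Relation.Binary.Bundles using (Setoid)
open import Relation.Binary.Structures using (IsEquivalence)
import Relation.Binary.Reasoning.Setoid as SetoidReasoning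

module GSCatProperties {o ℓ e} (C : GSCat o ℓ e) where
  open GSCat C

  hom-setoid : Obj → Obj → Setoid ℓ e
  hom-setoid X Y = record { Carrier = Hom X Y ; _≈_ = _≈_ ; isEquivalence = ≈-equiv }

  module ≈ {X Y} = IsEquivalence (≈-equiv {X} {Y})
  open ≈ public using (refl; sym; trans)
  module HomReasoning {X Y} = SetoidReasoning (hom-setoid X Y)

  infixr 4 refl⟩⨾⟨_
  infixl 5 _⟩⨾⟨refl

  refl⟩⨾⟨_ : ∀ {X Y Z} {f : Hom X Y} {g h : Hom Y Z} → g ≈ h → f ⨾ g ≈ f ⨾ h
  refl⟩⨾⟨ p = ⨾-resp refl p

  _⟩⨾⟨refl : ∀ {X Y Z} {f g : Hom X Y} {h : Hom Y Z} → f ≈ g → f ⨾ h ≈ g ⨾ h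
  p ⟩⨾⟨refl = ⨾-resp p refl

  sym-assoc : ∀ {W X Y Z} {f : Hom W X} {g : Hom X Y} {h : Hom Y Z} → f ⨾ g ⨾ h ≈ (f ⨾ g) ⨾ h
  sym-assoc = sym (assoc _ _ _)

  pullˡ : ∀ {W X Y Z} {f : Hom W X} {g : Hom X Y} {h : Hom W Y} {k : Hom Y Z} →
          f ⨾ g ≈ h → f ⨾ g ⨾ k ≈ h ⨾ k
  pullˡ p = trans sym-assoc (p ⟩⨾⟨refl)

  extendˡ : ∀ {W X X′ Y Z} {f : Hom W X} {g : Hom X Y} {h : Hom W X′} {i : Hom X′ Y} {k : Hom Y Z} →
            f ⨾ g ≈ h ⨾ i → f ⨾ g ⨾ k ≈ h ⨾ i ⨾ k
  extendˡ p = trans (pullˡ p) (assoc _ _ _)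

  pushˡ : ∀ {W X Y Z} {f : Hom W X} {g : Hom X Y} {h : Hom W Y} {k : Hom Y Z} →
          h ≈ f ⨾ g → h ⨾ k ≈ f ⨾ g ⨾ k
  pushˡ p = sym (pullˡ (sym p))

  cancel-idˡ : ∀ {X Y} {f g : Hom X Y} → id ⨾ f ≈ id ⨾ g → f ≈ g
  cancel-idˡ p = trans (sym (idˡ _)) (trans p (idˡ _))

  cancel-sectionʳ : ∀ {X Y Z} {f h : Hom X Y} {g : Hom Y Z} {g′ : Hom Z Y} →
                    g ⨾ g′ ≈ id → f ⨾ g ≈ h ⨾ g → f ≈ h
  cancel-sectionʳ {f = f} {h} {g} {g′} gg′ p = begin
    f              ≈⟨ idʳ f ⟨
    f ⨾ id         ≈⟨ refl⟩⨾⟨ gg′ ⟨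
    f ⨾ g ⨾ g′     ≈⟨ pullˡ p ⟩
    (h ⨾ g) ⨾ g′   ≈⟨ assoc _ _ _ ⟩
    h ⨾ g ⨾ g′     ≈⟨ refl⟩⨾⟨ gg′ ⟩
    h ⨾ id         ≈⟨ idʳ h ⟩
    h              ∎
    where open HomReasoning

  ⊗-⨾-idʳ : ∀ {X Y Z X′ Y′} (f : Hom X Y) (g : Hom Y Z) (h : Hom X′ Y′) →
            (f ⨾ g) ⊗₁ h ≈ (f ⊗₁ h) ⨾ (g ⊗₁ id)
  ⊗-⨾-idʳ f g h = trans (⊗-resp refl (sym (idʳ h))) (⊗-⨾ f g h id)

  ρ⁻¹-nat : ∀ {X Y} (f : Hom X Y) → ρ⁻¹ ⨾ f ≈ (f ⊗₁ id) ⨾ ρ⁻¹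
  ρ⁻¹-nat f = begin
    ρ⁻¹ ⨾ f                      ≈⟨ refl⟩⨾⟨ idʳ f ⟨
    ρ⁻¹ ⨾ f ⨾ id                 ≈⟨ refl⟩⨾⟨ refl⟩⨾⟨ ρ-iso₁ ⟨
    ρ⁻¹ ⨾ f ⨾ ρ ⨾ ρ⁻¹            ≈⟨ refl⟩⨾⟨ pullˡ (ρ-nat f) ⟩
    ρ⁻¹ ⨾ (ρ ⨾ (f ⊗₁ id)) ⨾ ρ⁻¹  ≈⟨ refl⟩⨾⟨ assoc _ _ _ ⟩
    ρ⁻¹ ⨾ ρ ⨾ (f ⊗₁ id) ⨾ ρ⁻¹    ≈⟨ pullˡ ρ-iso₂ ⟩
    id ⨾ (f ⊗₁ id) ⨾ ρ⁻¹         ≈⟨ idˡ _ ⟩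
    (f ⊗₁ id) ⨾ ρ⁻¹              ∎
    where open HomReasoning

module MonadProperties {o ℓ e} {C : GSCat o ℓ e} (M : SymMonoidalMonad C) where
  open GSCat C
  open GSCatProperties C
  open SymMonoidalMonad M
  open HomReasoning

  T-inverse : ∀ {X Y} {f : Hom X Y} {g : Hom Y X} → f ⨾ g ≈ id → T₁ f ⨾ T₁ g ≈ id
  T-inverse p = trans (sym (T-⨾ _ _)) (trans (T-resp p) T-id)

  η-bind : ∀ {X Y} (g : Hom X (T₀ Y)) → η ⨾ T₁ g ⨾ μ ≈ g
  η-bind g = begin
    η ⨾ T₁ g ⨾ μ  ≈⟨ extendˡ (η-nat g) ⟨
    g ⨾ η ⨾ μ     ≈⟨ refl⟩⨾⟨ μ-unitˡ ⟩
    g ⨾ id        ≈⟨ idʳ g ⟩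
    g             ∎

  T₁-pure-μ : ∀ {X Y} (f : Hom X Y) → T₁ (f ⨾ η) ⨾ μ ≈ T₁ f
  T₁-pure-μ f = begin
    T₁ (f ⨾ η) ⨾ μ    ≈⟨ T-⨾ f η ⟩⨾⟨refl ⟩
    (T₁ f ⨾ T₁ η) ⨾ μ ≈⟨ assoc _ _ _ ⟩
    T₁ f ⨾ T₁ η ⨾ μ   ≈⟨ refl⟩⨾⟨ μ-unitʳ ⟩
    T₁ f ⨾ id         ≈⟨ idʳ _ ⟩
    T₁ f              ∎

  scale : ∀ {X} → Hom (T₀ X ⊗₀ T₀ I) (T₀ X)
  scale = c ⨾ T₁ ρ⁻¹

  sq : Hom (T₀ I) (T₀ I)
  sq = ∇ ⨾ scale

  scale-natural : ∀ {X Y} (f : Hom X Y) → (T₁ f ⊗₁ id) ⨾ scale ≈ scale ⨾ T₁ f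
  scale-natural f = begin
    (T₁ f ⊗₁ id) ⨾ c ⨾ T₁ ρ⁻¹     ≈⟨ ⊗-resp refl T-id ⟩⨾⟨refl ⟨
    (T₁ f ⊗₁ T₁ id) ⨾ c ⨾ T₁ ρ⁻¹  ≈⟨ extendˡ (c-nat f id) ⟩
    c ⨾ T₁ (f ⊗₁ id) ⨾ T₁ ρ⁻¹     ≈⟨ refl⟩⨾⟨ T-⨾ _ _ ⟨
    c ⨾ T₁ ((f ⊗₁ id) ⨾ ρ⁻¹)      ≈⟨ refl⟩⨾⟨ T-resp (ρ⁻¹-nat f) ⟨
    c ⨾ T₁ (ρ⁻¹ ⨾ f)              ≈⟨ refl⟩⨾⟨ T-⨾ _ _ ⟩
    c ⨾ T₁ ρ⁻¹ ⨾ T₁ f             ≈⟨ sym-assoc ⟩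
    (c ⨾ T₁ ρ⁻¹) ⨾ T₁ f           ∎

  η⊗Tη-c-Tc-μ : ∀ {X Y} → (η {T₀ X} ⊗₁ T₁ (η {Y})) ⨾ c ⨾ T₁ c ⨾ μ ≈ c
  η⊗Tη-c-Tc-μ = begin
    (η ⊗₁ T₁ η) ⨾ c ⨾ T₁ c ⨾ μ    ≈⟨ refl⟩⨾⟨ μ-monoidal ⟨
    (η ⊗₁ T₁ η) ⨾ (μ ⊗₁ μ) ⨾ c    ≈⟨ pullˡ (sym (⊗-⨾ _ _ _ _)) ⟩
    ((η ⨾ μ) ⊗₁ (T₁ η ⨾ μ)) ⨾ c   ≈⟨ ⊗-resp μ-unitˡ μ-unitʳ ⟩⨾⟨refl ⟩
    (id ⊗₁ id) ⨾ c                ≈⟨ ⊗-id ⟩⨾⟨refl ⟩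
    id ⨾ c                        ≈⟨ idˡ c ⟩
    c                             ∎

  T₁ρ⁻¹-μ : ∀ {X} → T₁ (ρ⁻¹ {T₀ X}) ⨾ μ ≈ T₁ (id ⊗₁ η) ⨾ T₁ c ⨾ μ ⨾ T₁ ρ⁻¹
  T₁ρ⁻¹-μ = begin
    T₁ ρ⁻¹ ⨾ μ                                  ≈⟨ T-resp c-unitʳ ⟩⨾⟨refl ⟨
    T₁ ((id ⊗₁ η) ⨾ c ⨾ T₁ ρ⁻¹) ⨾ μ             ≈⟨ T-⨾ _ _ ⟩⨾⟨refl ⟩
    (T₁ (id ⊗₁ η) ⨾ T₁ (c ⨾ T₁ ρ⁻¹)) ⨾ μ        ≈⟨ assoc _ _ _ ⟩
    T₁ (id ⊗₁ η) ⨾ T₁ (c ⨾ T₁ ρ⁻¹) ⨾ μ          ≈⟨ refl⟩⨾⟨ T-⨾ _ _ ⟩⨾⟨refl ⟩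
    T₁ (id ⊗₁ η) ⨾ (T₁ c ⨾ T₁ (T₁ ρ⁻¹)) ⨾ μ     ≈⟨ refl⟩⨾⟨ assoc _ _ _ ⟩
    T₁ (id ⊗₁ η) ⨾ T₁ c ⨾ T₁ (T₁ ρ⁻¹) ⨾ μ       ≈⟨ refl⟩⨾⟨ refl⟩⨾⟨ μ-nat ρ⁻¹ ⟩
    T₁ (id ⊗₁ η) ⨾ T₁ c ⨾ μ ⨾ T₁ ρ⁻¹            ∎

  η⊗id-scale-μ : ∀ {X} → (η {T₀ X} ⊗₁ id) ⨾ scale ⨾ μ ≈ scale
  η⊗id-scale-μ = begin
    (η ⊗₁ id) ⨾ (c ⨾ T₁ ρ⁻¹) ⨾ μ                          ≈⟨ refl⟩⨾⟨ assoc _ _ _ ⟩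
    (η ⊗₁ id) ⨾ c ⨾ T₁ ρ⁻¹ ⨾ μ                            ≈⟨ refl⟩⨾⟨ refl⟩⨾⟨ T₁ρ⁻¹-μ ⟩
    (η ⊗₁ id) ⨾ c ⨾ T₁ (id ⊗₁ η) ⨾ T₁ c ⨾ μ ⨾ T₁ ρ⁻¹      ≈⟨ refl⟩⨾⟨ extendˡ (c-nat id η) ⟨
    (η ⊗₁ id) ⨾ (T₁ id ⊗₁ T₁ η) ⨾ c ⨾ T₁ c ⨾ μ ⨾ T₁ ρ⁻¹   ≈⟨ pullˡ (sym (⊗-⨾ _ _ _ _)) ⟩
    ((η ⨾ T₁ id) ⊗₁ (id ⨾ T₁ η)) ⨾ c ⨾ T₁ c ⨾ μ ⨾ T₁ ρ⁻¹  ≈⟨ ⊗-resp (trans (refl⟩⨾⟨ T-id) (idʳ η)) (idˡ _) ⟩⨾⟨refl ⟩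
    (η ⊗₁ T₁ η) ⨾ c ⨾ T₁ c ⨾ μ ⨾ T₁ ρ⁻¹                   ≈⟨ refl⟩⨾⟨ refl⟩⨾⟨ sym-assoc ⟩
    (η ⊗₁ T₁ η) ⨾ c ⨾ (T₁ c ⨾ μ) ⨾ T₁ ρ⁻¹                 ≈⟨ refl⟩⨾⟨ sym-assoc ⟩
    (η ⊗₁ T₁ η) ⨾ (c ⨾ T₁ c ⨾ μ) ⨾ T₁ ρ⁻¹                 ≈⟨ pullˡ η⊗Tη-c-Tc-μ ⟩
    c ⨾ T₁ ρ⁻¹                                            ∎

  scale-bind : ∀ {X Y Z} (m : Hom X (T₀ Y)) (n : Hom Z (T₀ I)) →
               (η ⊗₁ n) ⨾ scale ⨾ T₁ m ⨾ μ ≈ (m ⊗₁ n) ⨾ scale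
  scale-bind m n = begin
    (η ⊗₁ n) ⨾ scale ⨾ T₁ m ⨾ μ            ≈⟨ refl⟩⨾⟨ extendˡ (scale-natural m) ⟨
    (η ⊗₁ n) ⨾ (T₁ m ⊗₁ id) ⨾ scale ⨾ μ    ≈⟨ pullˡ (sym (⊗-⨾-idʳ η (T₁ m) n)) ⟩
    ((η ⨾ T₁ m) ⊗₁ n) ⨾ scale ⨾ μ          ≈⟨ ⊗-resp (η-nat m) refl ⟩⨾⟨refl ⟨
    ((m ⨾ η) ⊗₁ n) ⨾ scale ⨾ μ             ≈⟨ pushˡ (⊗-⨾-idʳ m η n) ⟩
    (m ⊗₁ n) ⨾ (η ⊗₁ id) ⨾ scale ⨾ μ       ≈⟨ refl⟩⨾⟨ η⊗id-scale-μ ⟩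
    (m ⊗₁ n) ⨾ scale                       ∎

module KleisliMass {o ℓ e} (C : RestrictionCat o ℓ e) (M : SymMonoidalMonad (RestrictionCat.gs C)) where
  open RestrictionCat C
  open GSCatProperties gs
  open SymMonoidalMonad M
  open MonadProperties M
  open HomReasoning
  private module K = GSData (Kleisli gs M)

  Kleisli-mass : ∀ {X Y} (f : Hom X (T₀ Y)) → K.mass f ≈ f ⨾ T₁ !
  Kleisli-mass f = refl⟩⨾⟨ T₁-pure-μ !

  Kleisli-dom : ∀ {X Y} (f : Hom X (T₀ Y)) → K.dom f ≈ ∇ ⨾ (η ⊗₁ K.mass f) ⨾ scale
  Kleisli-dom f = begin
    (∇ ⨾ η) ⨾ T₁ (((η ⊗₁ m) ⨾ c) ⨾ T₁ (ρ⁻¹ ⨾ η) ⨾ μ) ⨾ μ  ≈⟨ assoc _ _ _ ⟩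
    ∇ ⨾ η ⨾ T₁ (((η ⊗₁ m) ⨾ c) ⨾ T₁ (ρ⁻¹ ⨾ η) ⨾ μ) ⨾ μ    ≈⟨ refl⟩⨾⟨ η-bind _ ⟩
    ∇ ⨾ ((η ⊗₁ m) ⨾ c) ⨾ T₁ (ρ⁻¹ ⨾ η) ⨾ μ                ≈⟨ refl⟩⨾⟨ refl⟩⨾⟨ T₁-pure-μ ρ⁻¹ ⟩
    ∇ ⨾ ((η ⊗₁ m) ⨾ c) ⨾ T₁ ρ⁻¹                          ≈⟨ refl⟩⨾⟨ assoc _ _ _ ⟩
    ∇ ⨾ (η ⊗₁ m) ⨾ c ⨾ T₁ ρ⁻¹                            ∎
    where m = K.mass f

  copy-scale-bind : ∀ {X} (m : Hom X (T₀ I)) → (∇ ⨾ (η ⊗₁ m) ⨾ scale) ⨾ T₁ m ⨾ μ ≈ m ⨾ sq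
  copy-scale-bind m = begin
    (∇ ⨾ (η ⊗₁ m) ⨾ scale) ⨾ T₁ m ⨾ μ  ≈⟨ assoc _ _ _ ⟩
    ∇ ⨾ ((η ⊗₁ m) ⨾ scale) ⨾ T₁ m ⨾ μ  ≈⟨ refl⟩⨾⟨ assoc _ _ _ ⟩
    ∇ ⨾ (η ⊗₁ m) ⨾ scale ⨾ T₁ m ⨾ μ    ≈⟨ refl⟩⨾⟨ scale-bind m m ⟩
    ∇ ⨾ (m ⊗₁ m) ⨾ scale               ≈⟨ extendˡ (copyable m) ⟨
    m ⨾ ∇ ⨾ scale                      ∎

  Kleisli-dom-⨾-mass : ∀ {X Y} (f : Hom X (T₀ Y)) → K.dom f K.⨾ K.mass f ≈ f ⨾ T₁ ! ⨾ sq
  Kleisli-dom-⨾-mass f = begin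
    K.dom f ⨾ T₁ (K.mass f) ⨾ μ                     ≈⟨ Kleisli-dom f ⟩⨾⟨refl ⟩
    (∇ ⨾ (η ⊗₁ K.mass f) ⨾ scale) ⨾ T₁ (K.mass f) ⨾ μ ≈⟨ copy-scale-bind (K.mass f) ⟩
    K.mass f ⨾ sq                                   ≈⟨ Kleisli-mass f ⟩⨾⟨refl ⟩
    (f ⨾ T₁ !) ⨾ sq                                 ≈⟨ assoc _ _ _ ⟩
    f ⨾ T₁ ! ⨾ sq                                   ∎

  massCategory⇔ : IsMassCategory (Kleisli gs M) ⇔
                  (∀ {X Y : Obj} (f : Hom X (T₀ Y)) → f ⨾ T₁ ! ⨾ sq ≈ f ⨾ T₁ !)
  massCategory⇔ = mk⇔
    (λ mc {_} {_} f → trans (sym (Kleisli-dom-⨾-mass f)) (trans (mc f) (Kleisli-mass f)))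
    (λ fixed {_} {_} f → trans (Kleisli-dom-⨾-mass f) (trans (fixed f) (sym (Kleisli-mass f))))

  ∇-c-T₁!⊗! : ∀ {X} → ∇ ⨾ c ⨾ T₁ (! {X} ⊗₁ !) ≈ T₁ ! ⨾ sq ⨾ T₁ ρ
  ∇-c-T₁!⊗! = begin
    ∇ ⨾ c ⨾ T₁ (! ⊗₁ !)               ≈⟨ refl⟩⨾⟨ c-nat ! ! ⟨
    ∇ ⨾ (T₁ ! ⊗₁ T₁ !) ⨾ c            ≈⟨ extendˡ (copyable (T₁ !)) ⟨
    T₁ ! ⨾ ∇ ⨾ c                      ≈⟨ refl⟩⨾⟨ refl⟩⨾⟨ trans (refl⟩⨾⟨ T-inverse ρ-iso₂) (idʳ c) ⟨
    T₁ ! ⨾ ∇ ⨾ c ⨾ T₁ ρ⁻¹ ⨾ T₁ ρ      ≈⟨ refl⟩⨾⟨ refl⟩⨾⟨ sym-assoc ⟩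
    T₁ ! ⨾ ∇ ⨾ (c ⨾ T₁ ρ⁻¹) ⨾ T₁ ρ    ≈⟨ refl⟩⨾⟨ sym-assoc ⟩
    T₁ ! ⨾ (∇ ⨾ c ⨾ T₁ ρ⁻¹) ⨾ T₁ ρ    ∎

  massPreserving⇔ : IsMassPreserving gs M ⇔ (∀ X → T₁ (! {X}) ⨾ sq ≈ T₁ !)
  massPreserving⇔ = mk⇔
    (λ mp X → cancel-sectionʳ (T-inverse ρ-iso₁)
                (trans (assoc _ _ _) (trans (sym ∇-c-T₁!⊗!) (mp X))))
    (λ fixed X → trans ∇-c-T₁!⊗! (pullˡ (fixed X)))

open Equivalence using (to; from)

theorem5p4 : ∀ {o ℓ e} (C : RestrictionCat o ℓ e) (T : SymMonoidalMonad (RestrictionCat.gs C)) →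
    IsMassPreserving (RestrictionCat.gs C) T ⇔ IsMassCategory (Kleisli (RestrictionCat.gs C) T)
theorem5p4 C T = mk⇔ massCategory massPreserving
  where
  open RestrictionCat C
  open GSCatProperties gs
  open SymMonoidalMonad T
  open KleisliMass C T

  massCategory : IsMassPreserving gs T → IsMassCategory (Kleisli gs T)
  massCategory mp = from massCategory⇔ λ f → refl⟩⨾⟨ to massPreserving⇔ mp _

  massPreserving : IsMassCategory (Kleisli gs T) → IsMassPreserving gs T
  massPreserving mc = from massPreserving⇔ λ X → cancel-idˡ (to massCategory⇔ mc (id {T₀ X}))
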